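{- Let $n\geq 1$. Two permutations $\omega_1,\omega_2\in\mathcal{H}_n$ are $\mathcal{H}_{n-1}$-conjugate (i.e. $\omega_1=\alpha\omega_2\alpha^{ -1}$ for some $\alpha\in\mathcal{H}_{n-1}$) if and only if they have the same marked-type.
   Context: For $i\geq 1$ let $p_2(i)=\{2i-1,2i\}$. The hyperoctahedral group $\mathcal{H}_n$ is the subgroup of the symmetric group $\mathcal{S}_{2n}$ on $\{1,\dots,2n\}$ consisting of those $\omega$ such that for every $i\in\{1,\dots,n\}$ there is $j$ with $\omega(p_2(i))=p_2(j)$. $\mathcal{H}_{n-1}$ is regarded as the subgroup of $\mathcal{H}_n$ of elements fixing $2n-1$ and $2n$. For $a\in p_2(i)$ let $\overline{a}$ be the other element of $p_2(i)$; for a cycle $\mathcal{C}=(a_1,\dots,a_l)$ let $\overline{\mathcal{C}}=(\overline{a_1},\dots,\overline{a_l})$. For $\omega\in\mathcal{H}_n$, $\overline{\mathcal{C}}$ is again a cycle of $\omega$ whenever $\mathcal{C}$ is; either $\overline{\mathcal{C}}\neq\mathcal{C}$ (the cycles of $\omega$ then come in pairs $\mathcal{C},\overline{\mathcal{C}}$), or $\overline{\mathcal{C}}=\mathcal{C}$, in which case $\mathcal{C}$ has the form $(a_1,\dots,a_{j},\overline{a_1},\dots,\overline{a_j})$ of even length $2j$. Write the cycle decomposition as $\omega=\mathcal{C}_1\overline{\mathcal{C}_1}\cdots\mathcal{C}_k\overline{\mathcal{C}_k}\,\mathcal{D}_1\cdots\mathcal{D}_l$, where the $\mathcal{D}_m$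 are the self-paired cycles, of lengths $2d_m$. The type of $\omega$ is the bipartition $(\lambda_1,\lambda_2)$ of $n$ where $\lambda_1$ is the partition formed by the lengths of $\mathcal{C}_1,\dots,\mathcal{C}_k$ and $\lambda_2$ the partition formed by $d_1,\dots,d_l$. A marked bipartition is a bipartition together with a choice of one of its two components $i\in\{1,2\}$ and a part $r$ of $\lambda_i$ (the marked part). The marked-type of $\omega$ is: $(\lambda_1,\lambda_2)$ with $\lambda_1$ marked at $r$ if $2n-1$ and $2n$ lie in two distinct paired cycles $\mathcal{C}_j,\overline{\mathcal{C}_j}$ of length $r$; and $(\lambda_1,\lambda_2)$ with $\lambda_2$ marked at $r$ if $2n-1$ and $2n$ lie in the same self-paired cycle, of length $2r$. Two marked-types are equal if the bipartitions, the marked component and the marked part value coincide. -}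

module Defs where

open import Data.Nat using (ℕ; zero; suc; _+_; _*_; _≤ᵇ_; ⌊_/2⌋)
open import Data.Fin using (Fin; zero; suc; toℕ; fromℕ)
open import Data.Fin.Properties using () renaming (_≟_ to _≟ᶠ_)
open import Data.Product using (_×_; _,_; Σ; ∃; proj₁; proj₂)
open import Data.Product.Properties using (≡-dec)
open import Data.Sum using (_⊎_)
open import Data.Bool using (Bool; true; false; if_then_else_; not; _∧_)
open import Data.List using (List; []; _∷_; map; filterᵇ; upTo; allFin; cartesianProduct; _++_)
open import Data.Bool.ListAction using (any; all)
open import Data.List.Relation.Binary.Permutation.Propositional using (_↭_)
open import Relation.Binary.PropositionalEquality using (_≡_)
open import Relation.Nullary using (Dec; yes; no)
open import Relation.Nullary.Decidable using (⌊_⌋)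
open import Function.Bundles using (_↔_; Inverse)

-- Points {1,…,2n} are encoded as Fin n × Fin 2:
-- (i , 0) stands for 2i+1 and (i , 1) for 2i+2 (i 0-indexed), so the block
-- p₂(i+1) = {2i+1, 2i+2} is {(i,0),(i,1)}, and 2n-1, 2n are (last,0),(last,1).
Pt : ℕ → Set
Pt n = Fin n × Fin 2

_≟ₚ_ : ∀ {n} (x y : Pt n) → Dec (x ≡ y)
_≟ₚ_ = ≡-dec _≟ᶠ_ _≟ᶠ_

flip2 : Fin 2 → Fin 2
flip2 zero = suc zero
flip2 (suc zero) = zero

bar : ∀ {n} → Pt n → Pt n
bar (i , b) = (i , flip2 b)

Perm : ℕ → Set
Perm n = Pt n ↔ Pt n

app : ∀ {n} → Perm n → Pt n → Pt n
app ω = Inverse.to ω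

appInv : ∀ {n} → Perm n → Pt n → Pt n
appInv ω = Inverse.from ω

mapsBlockTo : ∀ {n} → Perm n → Fin n → Fin n → Set
mapsBlockTo ω i j =
  (app ω (i , zero) ≡ (j , zero) × app ω (i , suc zero) ≡ (j , suc zero))
  ⊎ (app ω (i , zero) ≡ (j , suc zero) × app ω (i , suc zero) ≡ (j , zero))

InH : (n : ℕ) → Perm n → Set
InH n ω = (i : Fin n) → ∃ λ (j : Fin n) → mapsBlockTo ω i j

-- H_{n-1} ⊂ H_n (here n = suc m): elements fixing 2n-1 and 2n
InHsub : (m : ℕ) → Perm (suc m) → Set
InHsub m α = InH (suc m) α
  × app α (fromℕ m , zero) ≡ (fromℕ m , zero)
  × app α (fromℕ m , suc zero) ≡ (fromℕ m , suc zero)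

HsubConj : (m : ℕ) → Perm (suc m) → Perm (suc m) → Set
HsubConj m ω₁ ω₂ = Σ (Perm (suc m)) λ α →
  InHsub m α × ((x : Pt (suc m)) → app ω₁ x ≡ app α (app ω₂ (appInv α x)))

iter : ∀ {n} → Perm n → ℕ → Pt n → Pt n
iter ω zero x = x
iter ω (suc k) x = app ω (iter ω k x)

eqᵇ : ∀ {n} → Pt n → Pt n → Bool
eqᵇ x y = ⌊ x ≟ₚ y ⌋

returnSearch : ∀ {n} → Perm n → Pt n → ℕ → ℕ → ℕ
returnSearch ω x zero k = k
returnSearch ω x (suc f) k =
  if eqᵇ (iter ω k x) x then k else returnSearch ω x f (suc k)

-- length of the cycle of ω containing x (least k ≥ 1 with ω^k x = x;
-- it is at most 2n)
cycLen : ∀ {n} → Perm n → Pt n → ℕ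
cycLen {n} ω x = returnSearch ω x (2 * n) 1

orbit : ∀ {n} → Perm n → Pt n → List (Pt n)
orbit ω x = map (λ k → iter ω k x) (upTo (cycLen ω x))

-- the cycle of x is self-paired (C̄ = C) iff x̄ lies in it
selfPaired : ∀ {n} → Perm n → Pt n → Bool
selfPaired ω x = any (eqᵇ (bar x)) (orbit ω x)

rank : ∀ {n} → Pt n → ℕ
rank (i , b) = 2 * toℕ i + toℕ b

allPts : (n : ℕ) → List (Pt n)
allPts n = cartesianProduct (allFin n) (allFin 2)

-- x is the smallest element of C ∪ C̄, C the cycle of x; each cycle pair
-- {C, C̄} resp. each self-paired cycle has exactly one representative
isRep : ∀ {n} → Perm n → Pt n → Bool
isRep ω x = all (λ y → rank x ≤ᵇ rank y) (orbit ω x ++ orbit ω (bar x))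

-- λ₁ : lengths of C₁,…,C_k (one per pair C, C̄)
lam1 : (n : ℕ) → Perm n → List ℕ
lam1 n ω = map (cycLen ω) (filterᵇ (λ x → isRep ω x ∧ not (selfPaired ω x)) (allPts n))

-- λ₂ : half-lengths d_m of the self-paired cycles D_m
lam2 : (n : ℕ) → Perm n → List ℕ
lam2 n ω = map (λ x → ⌊ cycLen ω x /2⌋) (filterᵇ (λ x → isRep ω x ∧ selfPaired ω x) (allPts n))

-- partitions are represented by lists of parts, compared up to reordering
record MarkedBipartition : Set where
  constructor mbp
  field
    part₁ : List ℕ
    part₂ : List ℕ
    markedComp : Fin 2      -- zero = λ₁, suc zero = λ₂
    markedPart : ℕ

_≈MT_ : MarkedBipartition → MarkedBipartition → Set
mbp a₁ a₂ c r ≈MT mbp b₁ b₂ d s = (a₁ ↭ b₁) × (a₂ ↭ b₂) × (c ≡ d) × (r ≡ s)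

markedType : (m : ℕ) → Perm (suc m) → MarkedBipartition
markedType m ω =
  if selfPaired ω u
  then mbp (lam1 (suc m) ω) (lam2 (suc m) ω) (suc zero) ⌊ cycLen ω u /2⌋
  else mbp (lam1 (suc m) ω) (lam2 (suc m) ω) zero (cycLen ω u)
  where
  u : Pt (suc m)
  u = (fromℕ m , zero)

module Submission where

-- Elements of H_n are exactly the permutations of the 2n points commuting with a ↦ ā. For such
-- ω the orbits of ⟨ω, bar⟩ are the unions C ∪ C̄ of paired cycles and the self-paired cycles, and
-- each orbit has a cycle type: the length of C and whether C = C̄. The bipartition is the multiset
-- of cycle types of the orbits, and the mark is the type of the orbit of 2n−1. A conjugator
-- α ∈ H_{n−1} carries the orbits of ω₂ onto those of ω₁, preserving types and fixing the orbit
-- of 2n−1. Conversely, pick transversals of the orbits of ω₂ and of ω₁ that start with 2n−1 and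
-- match them by type. For matched a, b the assignment bar^s (ω₂^k a) ↦ bar^s (ω₁^k b) is well
-- defined, because which exponents (s, k) reach the same point of an orbit depends only on its
-- type; it is a permutation commuting with bar, fixing 2n−1 (hence 2n) and conjugating ω₂ to ω₁.

open import Defs
open import Data.Nat using (ℕ; zero; suc; _+_; _*_; _∸_; _≤_; _<_; _%_; _/_; NonZero; >-nonZero; s≤s; ⌊_/2⌋)
open import Data.Nat.Properties
open import Data.Nat.DivMod using (m≡m%n+[m/n]*n; m%n<n)
open import Data.Fin using (Fin; zero; suc; toℕ; fromℕ; combine)
open import Data.Fin.Properties using (pigeonhole; combine-injective; toℕ-combine; toℕ-injective; toℕ<n)
open import Data.Product using (_×_; _,_; Σ; ∃; ∃₂; proj₁; proj₂; swap)
open import Data.Product.Properties using (,-injective)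
open import Data.Sum using (inj₁; inj₂)
open import Data.Bool using (Bool; true; false; T; not; _∧_; _xor_; if_then_else_)
open import Data.Bool.Properties using (T?; T-≡; T-not-≡; T-∧)
open import Data.Empty using (⊥-elim)
open import Data.List using (List; []; _∷_; map; filterᵇ; _++_)
open import Data.List.Properties using (map-∘; map-cong; map-cong-local; map-++)
open import Data.List.Membership.Propositional using (_∈_; find; lose)
open import Data.List.Membership.Propositional.Properties
  using (∈-map⁺; ∈-map⁻; ∈-upTo⁺; ∈-++⁺ˡ; ∈-++⁺ʳ; ∈-++⁻; ∈-∃++; ∈-filter⁺; ∈-filter⁻;
         ∈-cartesianProduct⁺; ∈-allFin)
open import Data.List.Membership.Propositional.Properties.WithK using (unique∧set⇒bag)
open import Data.List.Relation.Unary.Any using (here; there)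
open import Data.List.Relation.Unary.Any.Properties using (any⁺; any⁻)
open import Data.List.Relation.Unary.All as All using (All)
open import Data.List.Relation.Unary.All.Properties using (all⁺; all⁻)
open import Data.List.Extrema.Nat using (argmin; argmin-sel; f[argmin]≤f[xs])
open import Data.List.Relation.Unary.AllPairs using ([]; _∷_)
open import Data.List.Relation.Unary.Unique.Propositional using (Unique)
open import Data.List.Relation.Unary.Unique.Propositional.Properties as Unique
  using (filter⁺; cartesianProduct⁺; allFin⁺)
open import Data.List.Relation.Binary.BagAndSetEquality using (∼bag⇒↭)
open import Data.List.Relation.Binary.Permutation.Propositional
  using (_↭_; ↭-refl; ↭-sym; ↭-trans; ↭-reflexive; prep; ↭⇒↭ₛ; module PermutationReasoning)
open import Data.List.Relation.Binary.Permutation.Propositional.Properties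
  using (∈-resp-↭; map⁺; shift; drop-∷; ++⁺; filter-↭; ↭-empty-inv)
import Data.List.Relation.Binary.Permutation.Setoid.Properties as Setoid↭
open import Relation.Binary.PropositionalEquality
open import Relation.Binary.Definitions using (tri<; tri≈; tri>)
open import Relation.Nullary using (¬_; yes; no)
open import Relation.Nullary.Decidable using (toWitness; fromWitness)
open import Function.Base using (_∘_)
open import Function.Bundles using (_⇔_; mk⇔; Equivalence; Injection; Inverse; mk↔ₛ′)
open import Function.Properties.Inverse using (↔⇒↣)

module _ {A : Set} where

  Unique-resp-↭ : ∀ {xs ys : List A} → xs ↭ ys → Unique xs → Unique ys
  Unique-resp-↭ xs↭ys = Setoid↭.Unique-resp-↭ (setoid A) (↭⇒↭ₛ xs↭ys)

  ∈⇒↭-∷ : ∀ {x : A} {xs} → x ∈ xs → ∃ λ ys → xs ↭ x ∷ ys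
  ∈⇒↭-∷ {x} x∈xs with as , bs , refl ← ∈-∃++ x∈xs = as ++ bs , shift x as bs

  filterᵇ-split : (p q : A → Bool) (xs : List A) →
    filterᵇ p xs ↭ filterᵇ (λ x → p x ∧ not (q x)) xs ++ filterᵇ (λ x → p x ∧ q x) xs
  filterᵇ-split p q [] = ↭-refl
  filterᵇ-split p q (x ∷ xs) with p x | q x
  ... | true  | true  = ↭-trans (prep x (filterᵇ-split p q xs)) (↭-sym (shift x _ _))
  ... | true  | false = prep x (filterᵇ-split p q xs)
  ... | false | _     = filterᵇ-split p q xs

module _ {A B : Set} (f : A → B) where

  Unique-map⁺ : ∀ {xs} → Unique xs → (∀ {x y} → x ∈ xs → y ∈ xs → f x ≡ f y → x ≡ y) →
    Unique (map f xs)
  Unique-map⁺ {[]} _ _ = []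
  Unique-map⁺ {x ∷ xs} (x∉xs ∷ u) inj = All.tabulate fx≢ ∷ Unique-map⁺ u (λ p q → inj (there p) (there q))
    where
    fx≢ : ∀ {w} → w ∈ map f xs → f x ≢ w
    fx≢ w∈ fx≡w with y , y∈ , refl ← ∈-map⁻ f w∈ = All.lookup x∉xs y∈ (inj (here refl) (there y∈) fx≡w)

  Unique-map⁻ : ∀ {xs} → Unique (map f xs) → ∀ {x y} → x ∈ xs → y ∈ xs → f x ≡ f y → x ≡ y
  Unique-map⁻ (_ ∷ _) (here refl) (here refl) _ = refl
  Unique-map⁻ (fx∉ ∷ _) (here refl) (there y∈) e = ⊥-elim (All.lookup fx∉ (∈-map⁺ f y∈) e)
  Unique-map⁻ (fy∉ ∷ _) (there x∈) (here refl) e = ⊥-elim (All.lookup fy∉ (∈-map⁺ f x∈) (sym e))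
  Unique-map⁻ (_ ∷ u) (there x∈) (there y∈) e = Unique-map⁻ u x∈ y∈ e

module _ {A B K : Set} (f : A → K) (g : B → K) where

  ↭-matching : ∀ xs ys → map f xs ↭ map g ys →
    ∃ λ (M : List (A × B)) → map proj₁ M ↭ xs × map proj₂ M ↭ ys ×
                             (∀ {p} → p ∈ M → f (proj₁ p) ≡ g (proj₂ p))
  ↭-matching [] ys fxs↭gys with [] ← ys | refl ← ↭-empty-inv (↭-sym fxs↭gys) = [] , ↭-refl , ↭-refl , λ ()
  ↭-matching (x ∷ xs) ys fxs↭gys
    with y , y∈ys , fx≡gy ← ∈-map⁻ g (∈-resp-↭ fxs↭gys (here refl))
    with ys′ , ys↭ ← ∈⇒↭-∷ y∈ys
    with M , M↭xs , M↭ys′ , matched ← ↭-matching xs ys′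
           (drop-∷ (↭-trans fxs↭gys (↭-trans (map⁺ g ys↭) (↭-reflexive (cong (_∷ map g ys′) (sym fx≡gy))))))
    = (x , y) ∷ M , prep x M↭xs , ↭-trans (prep y M↭ys′) (↭-sym ys↭) , matched′
    where
    matched′ : ∀ {p} → p ∈ (x , y) ∷ M → f (proj₁ p) ≡ g (proj₂ p)
    matched′ (here refl) = fx≡gy
    matched′ (there p∈M) = matched p∈M

encode : ∀ {N} → Pt N → Fin (N * 2)
encode (i , b) = combine i b

encode-injective : ∀ {N} {x y : Pt N} → encode x ≡ encode y → x ≡ y
encode-injective {x = i , b} {j , c} e with refl , refl ← combine-injective i b j c e = refl

rank-injective : ∀ {N} {x y : Pt N} → rank x ≡ rank y → x ≡ y
rank-injective {x = i , b} {j , c} e =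
  encode-injective (toℕ-injective (trans (toℕ-combine i b) (trans e (sym (toℕ-combine j c)))))

∈-allPts : ∀ {N} (x : Pt N) → x ∈ allPts N
∈-allPts (i , b) = ∈-cartesianProduct⁺ (∈-allFin i) (∈-allFin b)

allPts-unique : ∀ N → Unique (allPts N)
allPts-unique N = cartesianProduct⁺ (allFin⁺ N) (allFin⁺ 2)

bar-involutive : ∀ {N} (x : Pt N) → bar (bar x) ≡ x
bar-involutive (i , zero) = refl
bar-involutive (i , suc zero) = refl

bar-injective : ∀ {N} {x y : Pt N} → bar x ≡ bar y → x ≡ y
bar-injective {x = x} {y} e = trans (sym (bar-involutive x)) (trans (cong bar e) (bar-involutive y))

bar-≢ : ∀ {N} (x : Pt N) → bar x ≢ x
bar-≢ (i , zero) ()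
bar-≢ (i , suc zero) ()

barIf : ∀ {N} → Bool → Pt N → Pt N
barIf false x = x
barIf true x = bar x

barIf-barIf : ∀ {N} s s′ (x : Pt N) → barIf s (barIf s′ x) ≡ barIf (s xor s′) x
barIf-barIf false s′ x = refl
barIf-barIf true false x = refl
barIf-barIf true true x = bar-involutive x

barIf-involutive : ∀ {N} s (x : Pt N) → barIf s (barIf s x) ≡ x
barIf-involutive false x = refl
barIf-involutive true x = bar-involutive x

barIf-injective : ∀ {N} s {x y : Pt N} → barIf s x ≡ barIf s y → x ≡ y
barIf-injective false e = e
barIf-injective true e = bar-injective e

module _ {N : ℕ} (ω : Perm N) where

  app-injective : ∀ {x y} → app ω x ≡ app ω y → x ≡ y
  app-injective = Injection.injective (↔⇒↣ ω)

  iter-+ : ∀ a b x → iter ω (a + b) x ≡ iter ω a (iter ω b x)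
  iter-+ zero b x = refl
  iter-+ (suc a) b x = cong (app ω) (iter-+ a b x)

  iter-injective : ∀ k {x y} → iter ω k x ≡ iter ω k y → x ≡ y
  iter-injective zero e = e
  iter-injective (suc k) e = iter-injective k (app-injective e)

  iter-multiple : ∀ {L x} → iter ω L x ≡ x → ∀ q → iter ω (q * L) x ≡ x
  iter-multiple e zero = refl
  iter-multiple {L} {x} e (suc q) = trans (iter-+ L (q * L) x) (trans (cong (iter ω L) (iter-multiple e q)) e)

  ∃-period : ∀ x → ∃ λ d → 1 ≤ d × d ≤ 2 * N × iter ω d x ≡ x
  ∃-period x with i , j , i<j , e ← pigeonhole (n<1+n (N * 2)) (λ t → encode (iter ω (toℕ t) x)) =
    toℕ j ∸ toℕ i , m<n⇒0<n∸m i<j , d≤2N , iter-injective (toℕ i) returns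
    where
    d≤2N : toℕ j ∸ toℕ i ≤ 2 * N
    d≤2N = ≤-trans (m∸n≤m (toℕ j) (toℕ i)) (≤-trans (≤-pred (toℕ<n j)) (≤-reflexive (*-comm N 2)))
    returns : iter ω (toℕ i) (iter ω (toℕ j ∸ toℕ i) x) ≡ iter ω (toℕ i) x
    returns = trans (sym (iter-+ (toℕ i) _ x))
      (trans (cong (λ t → iter ω t x) (m+[n∸m]≡n (<⇒≤ i<j))) (sym (encode-injective e)))

  returnSearch-spec : ∀ x fuel k j → k ≤ j → j < k + fuel → iter ω j x ≡ x →
    let r = returnSearch ω x fuel k in
    k ≤ r × iter ω r x ≡ x × (∀ i → k ≤ i → i < r → iter ω i x ≢ x)
  returnSearch-spec x zero k j k≤j j<k+0 _ =
    ⊥-elim (<-irrefl refl (≤-trans j<k+0 (≤-trans (≤-reflexive (+-identityʳ k)) k≤j)))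
  returnSearch-spec x (suc fuel) k j k≤j j<k+fuel e with iter ω k x ≟ₚ x
  ... | yes found = ≤-refl , found , λ i k≤i i<k → ⊥-elim (<-irrefl refl (≤-trans i<k k≤i))
  ... | no missed with m≤n⇒m<n∨m≡n k≤j
  ...   | inj₂ refl = ⊥-elim (missed e)
  ...   | inj₁ k<j with returnSearch-spec x fuel (suc k) j k<j (≤-trans j<k+fuel (≤-reflexive (+-suc k fuel))) e
  ...     | k<r , returns , minimal = <⇒≤ k<r , returns , earlier
    where
    earlier : ∀ i → k ≤ i → i < returnSearch ω x fuel (suc k) → iter ω i x ≢ x
    earlier i k≤i i<r with m≤n⇒m<n∨m≡n k≤i
    ... | inj₁ k<i = minimal i k<i i<r
    ... | inj₂ refl = missed

  -- The pigeonhole bound d ≤ 2N is what makes the fuel 2N of the search defining cycLen sufficient.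
  cycLen-spec : ∀ x →
    1 ≤ cycLen ω x × iter ω (cycLen ω x) x ≡ x × (∀ i → 1 ≤ i → i < cycLen ω x → iter ω i x ≢ x)
  cycLen-spec x with d , 1≤d , d≤2N , e ← ∃-period x = returnSearch-spec x (2 * N) 1 d 1≤d (s≤s d≤2N) e

  cycLen-positive : ∀ x → 1 ≤ cycLen ω x
  cycLen-positive x = proj₁ (cycLen-spec x)

  iter-cycLen : ∀ x → iter ω (cycLen ω x) x ≡ x
  iter-cycLen x = proj₁ (proj₂ (cycLen-spec x))

  iter-<cycLen : ∀ x i → 1 ≤ i → i < cycLen ω x → iter ω i x ≢ x
  iter-<cycLen x = proj₂ (proj₂ (cycLen-spec x))

cycLen-nonZero : ∀ {N} (ω : Perm N) x → NonZero (cycLen ω x)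
cycLen-nonZero ω x = >-nonZero (cycLen-positive ω x)

module _ {N : ℕ} (ω : Perm N) (x : Pt N) where

  private instance
    _ = cycLen-nonZero ω x

  iter-% : ∀ k → iter ω k x ≡ iter ω (k % cycLen ω x) x
  iter-% k = begin
    iter ω k x                                ≡⟨ cong (λ t → iter ω t x) (m≡m%n+[m/n]*n k L) ⟩
    iter ω (k % L + (k / L) * L) x            ≡⟨ iter-+ ω (k % L) _ x ⟩
    iter ω (k % L) (iter ω ((k / L) * L) x)   ≡⟨ cong (iter ω (k % L)) (iter-multiple ω (iter-cycLen ω x) (k / L)) ⟩
    iter ω (k % L) x                          ∎
    where
    open ≡-Reasoning
    L = cycLen ω x

  iter-distinct-in-cycle : ∀ {c d} → c < d → d < cycLen ω x → iter ω d x ≢ iter ω c x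
  iter-distinct-in-cycle {c} {d} c<d d<L e =
    iter-<cycLen ω x (d ∸ c) (m<n⇒0<n∸m c<d) (≤-<-trans (m∸n≤m d c) d<L) (iter-injective ω c (begin
      iter ω c (iter ω (d ∸ c) x)   ≡⟨ iter-+ ω c (d ∸ c) x ⟨
      iter ω (c + (d ∸ c)) x        ≡⟨ cong (λ t → iter ω t x) (m+[n∸m]≡n (<⇒≤ c<d)) ⟩
      iter ω d x                    ≡⟨ e ⟩
      iter ω c x                    ∎))
    where open ≡-Reasoning

  iter-injectiveOn-cycle : ∀ {a b} → a < cycLen ω x → b < cycLen ω x → iter ω a x ≡ iter ω b x → a ≡ b
  iter-injectiveOn-cycle {a} {b} a<L b<L e with <-cmp a b
  ... | tri≈ _ a≡b _ = a≡b
  ... | tri< a<b _ _ = ⊥-elim (iter-distinct-in-cycle a<b b<L (sym e))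
  ... | tri> _ _ b<a = ⊥-elim (iter-distinct-in-cycle b<a a<L e)

  iter-≡⇔%-≡ : ∀ i j → (iter ω i x ≡ iter ω j x) ⇔ (i % cycLen ω x ≡ j % cycLen ω x)
  iter-≡⇔%-≡ i j = mk⇔
    (λ e → iter-injectiveOn-cycle (m%n<n i _) (m%n<n j _) (trans (sym (iter-% i)) (trans e (iter-% j))))
    (λ e → trans (iter-% i) (trans (cong (λ t → iter ω t x) e) (sym (iter-% j))))

  iter-inverse : ∀ k → iter ω ((cycLen ω x ∸ 1) * k) (iter ω k x) ≡ x
  iter-inverse k = begin
    iter ω ((L ∸ 1) * k) (iter ω k x)   ≡⟨ iter-+ ω ((L ∸ 1) * k) k x ⟨
    iter ω ((L ∸ 1) * k + k) x          ≡⟨ cong (λ t → iter ω t x) exponent ⟩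
    iter ω (k * L) x                    ≡⟨ iter-multiple ω (iter-cycLen ω x) k ⟩
    x                                   ∎
    where
    open ≡-Reasoning
    L = cycLen ω x
    exponent : (L ∸ 1) * k + k ≡ k * L
    exponent = begin
      (L ∸ 1) * k + k   ≡⟨ +-comm ((L ∸ 1) * k) k ⟩
      (1 + (L ∸ 1)) * k ≡⟨ cong (_* k) (trans (+-comm 1 (L ∸ 1)) (m∸n+n≡m (cycLen-positive ω x))) ⟩
      L * k             ≡⟨ *-comm L k ⟩
      k * L             ∎

  iter-return-below-2L : ∀ {n} → 1 ≤ n → n < cycLen ω x + cycLen ω x → iter ω n x ≡ x → n ≡ cycLen ω x
  iter-return-below-2L {n} 1≤n n<2L returns with <-cmp n (cycLen ω x)
  ... | tri≈ _ n≡L _ = n≡L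
  ... | tri< n<L _ _ = ⊥-elim (iter-<cycLen ω x n 1≤n n<L returns)
  ... | tri> _ _ L<n = ⊥-elim (iter-<cycLen ω x (n ∸ L) (m<n⇒0<n∸m L<n) (m<n+o⇒m∸n<o n L n<2L) returns-earlier)
    where
    L = cycLen ω x
    returns-earlier : iter ω (n ∸ L) x ≡ x
    returns-earlier = begin
      iter ω (n ∸ L) x              ≡⟨ cong (iter ω (n ∸ L)) (iter-cycLen ω x) ⟨
      iter ω (n ∸ L) (iter ω L x)   ≡⟨ iter-+ ω (n ∸ L) L x ⟨
      iter ω (n ∸ L + L) x          ≡⟨ cong (λ t → iter ω t x) (m∸n+n≡m (<⇒≤ L<n)) ⟩
      iter ω n x                    ≡⟨ returns ⟩
      x                             ∎
      where open ≡-Reasoning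

cycLen-≡ : ∀ {N} {ω ω′ : Perm N} {x y} →
  iter ω′ (cycLen ω x) y ≡ y → iter ω (cycLen ω′ y) x ≡ x → cycLen ω x ≡ cycLen ω′ y
cycLen-≡ {ω = ω} {ω′} {x} {y} ex ey with <-cmp (cycLen ω x) (cycLen ω′ y)
... | tri≈ _ eq _ = eq
... | tri< lt _ _ = ⊥-elim (iter-<cycLen ω′ y _ (cycLen-positive ω x) lt ex)
... | tri> _ _ gt = ⊥-elim (iter-<cycLen ω x _ (cycLen-positive ω′ y) gt ey)

%-≡-resp-divisor : ∀ {L L′} → L ≡ L′ → .{{_ : NonZero L}} .{{_ : NonZero L′}} →
  ∀ {i j} → i % L ≡ j % L → i % L′ ≡ j % L′
%-≡-resp-divisor refl e = e

iter-≡-transfer : ∀ {N} {ω ω′ : Perm N} {x y} → cycLen ω x ≡ cycLen ω′ y →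
  ∀ i j → iter ω i x ≡ iter ω j x → iter ω′ i y ≡ iter ω′ j y
iter-≡-transfer {ω = ω} {ω′} {x} {y} L≡L′ i j e = Equivalence.from (iter-≡⇔%-≡ ω′ y i j)
  (%-≡-resp-divisor L≡L′ {{cycLen-nonZero ω x}} {{cycLen-nonZero ω′ y}}
    (Equivalence.to (iter-≡⇔%-≡ ω x i j) e))

T-⇔⇒≡ : ∀ {a b : Bool} → (T a → T b) → (T b → T a) → a ≡ b
T-⇔⇒≡ {false} {false} _ _ = refl
T-⇔⇒≡ {false} {true} _ b⇒a = ⊥-elim (b⇒a _)
T-⇔⇒≡ {true} {false} a⇒b _ = ⊥-elim (a⇒b _)
T-⇔⇒≡ {true} {true} _ _ = refl

module _ {N : ℕ} (ω : Perm N) where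

  iter∈orbit : ∀ k x → iter ω k x ∈ orbit ω x
  iter∈orbit k x rewrite iter-% ω x k =
    ∈-map⁺ (λ t → iter ω t x) (∈-upTo⁺ (m%n<n k (cycLen ω x) {{cycLen-nonZero ω x}}))

  ∈orbit⇒iter : ∀ {x y} → y ∈ orbit ω x → ∃ λ k → y ≡ iter ω k x
  ∈orbit⇒iter y∈ with k , _ , y≡ ← ∈-map⁻ _ y∈ = k , y≡

  selfPaired⇔ : ∀ x → T (selfPaired ω x) ⇔ (∃ λ k → bar x ≡ iter ω k x)
  selfPaired⇔ x = mk⇔ to from
    where
    to : T (selfPaired ω x) → ∃ λ k → bar x ≡ iter ω k x
    to sp with y , y∈ , bx≡y ← find (any⁻ _ (orbit ω x) sp)
          with k , y≡ ← ∈orbit⇒iter y∈ = k , trans (toWitness bx≡y) y≡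
    from : (∃ λ k → bar x ≡ iter ω k x) → T (selfPaired ω x)
    from (k , bx≡) = any⁺ _ (lose (iter∈orbit k x) (fromWitness bx≡))

-- y lies in the orbit of x under ⟨ω, bar⟩; for ω ∈ H this is C ∪ C̄ with C the cycle of x.
SameOrbit : ∀ {N} → Perm N → Pt N → Pt N → Set
SameOrbit ω x y = ∃₂ λ k s → y ≡ barIf s (iter ω k x)

cycleType : ∀ {N} → Perm N → Pt N → ℕ × Bool
cycleType ω x = cycLen ω x , selfPaired ω x

module Intertwining {N : ℕ} {ω ω′ : Perm N} (h : Pt N → Pt N)
  (h-injective : ∀ {x y} → h x ≡ h y → x ≡ y)
  (h-step : ∀ y → h (app ω′ y) ≡ app ω (h y)) where

  iter-h : ∀ k y → iter ω k (h y) ≡ h (iter ω′ k y)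
  iter-h zero y = refl
  iter-h (suc k) y = trans (cong (app ω) (iter-h k y)) (sym (h-step _))

  cycLen-h : ∀ y → cycLen ω (h y) ≡ cycLen ω′ y
  cycLen-h y = cycLen-≡ (h-injective (trans (sym (iter-h (cycLen ω (h y)) y)) (iter-cycLen ω (h y))))
                        (trans (iter-h (cycLen ω′ y) y) (cong h (iter-cycLen ω′ y)))

  module _ (h-bar : ∀ y → h (bar y) ≡ bar (h y)) where

    barIf-h : ∀ s y → h (barIf s y) ≡ barIf s (h y)
    barIf-h false y = refl
    barIf-h true y = h-bar y

    selfPaired-h : ∀ y → selfPaired ω (h y) ≡ selfPaired ω′ y
    selfPaired-h y = T-⇔⇒≡
      (λ sp → let k , e = Equivalence.to (selfPaired⇔ ω (h y)) sp in
        Equivalence.from (selfPaired⇔ ω′ y) (k , h-injective (trans (h-bar y) (trans e (iter-h k y)))))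
      (λ sp → let k , e = Equivalence.to (selfPaired⇔ ω′ y) sp in
        Equivalence.from (selfPaired⇔ ω (h y)) (k , trans (sym (h-bar y)) (trans (cong h e) (sym (iter-h k y)))))

    cycleType-h : ∀ y → cycleType ω (h y) ≡ cycleType ω′ y
    cycleType-h y = cong₂ _,_ (cycLen-h y) (selfPaired-h y)

    SameOrbit-h⁺ : ∀ {a b} → SameOrbit ω′ a b → SameOrbit ω (h a) (h b)
    SameOrbit-h⁺ {a} (k , s , refl) = k , s , trans (barIf-h s _) (cong (barIf s) (sym (iter-h k a)))

    SameOrbit-h⁻ : ∀ {a b} → SameOrbit ω (h a) (h b) → SameOrbit ω′ a b
    SameOrbit-h⁻ {a} (k , s , e) = k , s , h-injective (trans e (trans (cong (barIf s) (iter-h k a)) (sym (barIf-h s _))))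

CommutesWithBar : ∀ {N} → Perm N → Set
CommutesWithBar ω = ∀ x → app ω (bar x) ≡ bar (app ω x)

Intertwines : ∀ {N} → Perm N → Perm N → Perm N → Set
Intertwines α ωa ωb = ∀ y → app α (app ωa y) ≡ app ωb (app α y)

InH⇒CommutesWithBar : ∀ {N} {ω : Perm N} → InH N ω → CommutesWithBar ω
InH⇒CommutesWithBar ω∈H (i , zero) with ω∈H i
... | _ , inj₁ (e₀ , e₁) = trans e₁ (cong bar (sym e₀))
... | _ , inj₂ (e₀ , e₁) = trans e₁ (cong bar (sym e₀))
InH⇒CommutesWithBar ω∈H (i , suc zero) with ω∈H i
... | _ , inj₁ (e₀ , e₁) = trans e₀ (cong bar (sym e₁))
... | _ , inj₂ (e₀ , e₁) = trans e₀ (cong bar (sym e₁))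

CommutesWithBar⇒InH : ∀ {N} {ω : Perm N} → CommutesWithBar ω → InH N ω
CommutesWithBar⇒InH {ω = ω} ω-bar i = block (app ω (i , zero)) refl
  where
  block : ∀ v → app ω (i , zero) ≡ v → ∃ λ j → mapsBlockTo ω i j
  block (j , zero) e₀ = j , inj₁ (e₀ , trans (ω-bar (i , zero)) (cong bar e₀))
  block (j , suc zero) e₀ = j , inj₂ (e₀ , trans (ω-bar (i , zero)) (cong bar e₀))

halfIf : Bool → ℕ → ℕ
halfIf s L = if s then ⌊ L /2⌋ else 0

module CommutingWithBar {N : ℕ} {ω : Perm N} (ω-bar : CommutesWithBar ω) where

  private
    module ByBar = Intertwining {ω = ω} {ω′ = ω} bar bar-injective (λ y → sym (ω-bar y))
    module ByStep = Intertwining {ω = ω} {ω′ = ω} (app ω) (app-injective ω) (λ _ → refl)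

  iter-barIf : ∀ s k x → iter ω k (barIf s x) ≡ barIf s (iter ω k x)
  iter-barIf false k x = refl
  iter-barIf true k x = ByBar.iter-h k x

  cycleType-iter : ∀ k x → cycleType ω (iter ω k x) ≡ cycleType ω x
  cycleType-iter zero x = refl
  cycleType-iter (suc k) x = trans (ByStep.cycleType-h ω-bar (iter ω k x)) (cycleType-iter k x)

  cycleType-barIf : ∀ s x → cycleType ω (barIf s x) ≡ cycleType ω x
  cycleType-barIf false x = refl
  cycleType-barIf true x = ByBar.cycleType-h (λ _ → refl) x

  SameOrbit-refl : ∀ x → SameOrbit ω x x
  SameOrbit-refl x = 0 , false , refl

  SameOrbit-sym : ∀ {x y} → SameOrbit ω x y → SameOrbit ω y x
  SameOrbit-sym {x} (k , s , refl) = j , s , (begin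
    x                                           ≡⟨ iter-inverse ω x k ⟨
    iter ω j (iter ω k x)                       ≡⟨ cong (iter ω j) (barIf-involutive s _) ⟨
    iter ω j (barIf s (barIf s (iter ω k x)))   ≡⟨ iter-barIf s j _ ⟩
    barIf s (iter ω j (barIf s (iter ω k x)))   ∎)
    where
    open ≡-Reasoning
    j = (cycLen ω x ∸ 1) * k

  SameOrbit-trans : ∀ {x y z} → SameOrbit ω x y → SameOrbit ω y z → SameOrbit ω x z
  SameOrbit-trans {x} (k , s , refl) (k′ , s′ , refl) = k′ + k , s′ xor s , (begin
    barIf s′ (iter ω k′ (barIf s (iter ω k x)))   ≡⟨ cong (barIf s′) (iter-barIf s k′ _) ⟩
    barIf s′ (barIf s (iter ω k′ (iter ω k x)))   ≡⟨ barIf-barIf s′ s _ ⟩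
    barIf (s′ xor s) (iter ω k′ (iter ω k x))     ≡⟨ cong (barIf (s′ xor s)) (iter-+ ω k′ k x) ⟨
    barIf (s′ xor s) (iter ω (k′ + k) x)          ∎)
    where open ≡-Reasoning

  cycleType-resp : ∀ {x y} → SameOrbit ω x y → cycleType ω y ≡ cycleType ω x
  cycleType-resp {x} (k , s , refl) = trans (cycleType-barIf s _) (cycleType-iter k x)

  selfPaired-structure : ∀ x → T (selfPaired ω x) →
    bar x ≡ iter ω ⌊ cycLen ω x /2⌋ x × cycLen ω x ≡ ⌊ cycLen ω x /2⌋ + ⌊ cycLen ω x /2⌋
  selfPaired-structure x sp =
    subst (λ t → bar x ≡ iter ω t x) j≡half bx≡ , trans (sym j+j≡L) (cong₂ _+_ j≡half j≡half)
    where
    L = cycLen ω x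
    instance _ = cycLen-nonZero ω x
    k = proj₁ (Equivalence.to (selfPaired⇔ ω x) sp)
    j = k % L
    bx≡ : bar x ≡ iter ω j x
    bx≡ = trans (proj₂ (Equivalence.to (selfPaired⇔ ω x) sp)) (iter-% ω x k)
    j≢0 : j ≢ 0
    j≢0 j≡0 = bar-≢ x (trans bx≡ (cong (λ t → iter ω t x) j≡0))
    j+j-returns : iter ω (j + j) x ≡ x
    j+j-returns = begin
      iter ω (j + j) x          ≡⟨ iter-+ ω j j x ⟩
      iter ω j (iter ω j x)     ≡⟨ cong (iter ω j) bx≡ ⟨
      iter ω j (bar x)          ≡⟨ iter-barIf true j x ⟩
      bar (iter ω j x)          ≡⟨ cong bar bx≡ ⟨
      bar (bar x)               ≡⟨ bar-involutive x ⟩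
      x                         ∎
      where open ≡-Reasoning
    j+j≡L : j + j ≡ L
    j+j≡L = iter-return-below-2L ω x (≤-trans (n≢0⇒n>0 j≢0) (m≤m+n j j))
                                      (+-mono-< (m%n<n k L) (m%n<n k L)) j+j-returns
    j≡half : j ≡ ⌊ L /2⌋
    j≡half = trans (n≡⌊n+n/2⌋ j) (cong ⌊_/2⌋ j+j≡L)

  bar-iter-≡-iter⇒selfPaired : ∀ {x} k k′ → bar (iter ω k x) ≡ iter ω k′ x → T (selfPaired ω x)
  bar-iter-≡-iter⇒selfPaired {x} k k′ e = Equivalence.from (selfPaired⇔ ω x) (j + k′ , (begin
    bar x                          ≡⟨ iter-inverse ω (bar x) k ⟨
    iter ω j (iter ω k (bar x))    ≡⟨ cong (iter ω j) (trans (iter-barIf true k x) e) ⟩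
    iter ω j (iter ω k′ x)         ≡⟨ iter-+ ω j k′ x ⟨
    iter ω (j + k′) x              ∎))
    where
    open ≡-Reasoning
    j = (cycLen ω (bar x) ∸ 1) * k

  barIf-iter-selfPaired : ∀ {x} → T (selfPaired ω x) →
    ∀ s k → barIf s (iter ω k x) ≡ iter ω (k + halfIf s (cycLen ω x)) x
  barIf-iter-selfPaired {x} sp false k = cong (λ t → iter ω t x) (sym (+-identityʳ k))
  barIf-iter-selfPaired {x} sp true k = begin
    bar (iter ω k x)                     ≡⟨ iter-barIf true k x ⟨
    iter ω k (bar x)                     ≡⟨ cong (iter ω k) (proj₁ (selfPaired-structure x sp)) ⟩
    iter ω k (iter ω ⌊ cycLen ω x /2⌋ x)  ≡⟨ iter-+ ω k _ x ⟨
    iter ω (k + ⌊ cycLen ω x /2⌋) x       ∎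
    where open ≡-Reasoning

  barIf-iter-notSelfPaired : ∀ {x} → ¬ T (selfPaired ω x) →
    ∀ {s s′ k k′} → barIf s (iter ω k x) ≡ barIf s′ (iter ω k′ x) → s ≡ s′
  barIf-iter-notSelfPaired ¬sp {false} {false} e = refl
  barIf-iter-notSelfPaired ¬sp {false} {true} {k} {k′} e = ⊥-elim (¬sp (bar-iter-≡-iter⇒selfPaired k′ k (sym e)))
  barIf-iter-notSelfPaired ¬sp {true} {false} {k} {k′} e = ⊥-elim (¬sp (bar-iter-≡-iter⇒selfPaired k k′ e))
  barIf-iter-notSelfPaired ¬sp {true} {true} e = refl

  ∈orbitPair⇔SameOrbit : ∀ {x y} → (y ∈ orbit ω x ++ orbit ω (bar x)) ⇔ SameOrbit ω x y
  ∈orbitPair⇔SameOrbit {x} = mk⇔ to from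
    where
    to : ∀ {y} → y ∈ orbit ω x ++ orbit ω (bar x) → SameOrbit ω x y
    to y∈ with ∈-++⁻ (orbit ω x) y∈
    ... | inj₁ y∈C with k , y≡ ← ∈orbit⇒iter ω y∈C = k , false , y≡
    ... | inj₂ y∈C̄ with k , y≡ ← ∈orbit⇒iter ω y∈C̄ = k , true , trans y≡ (iter-barIf true k x)
    from : ∀ {y} → SameOrbit ω x y → y ∈ orbit ω x ++ orbit ω (bar x)
    from (k , false , refl) = ∈-++⁺ˡ (iter∈orbit ω k x)
    from (k , true , refl) =
      ∈-++⁺ʳ (orbit ω x) (subst (_∈ orbit ω (bar x)) (iter-barIf true k x) (iter∈orbit ω k (bar x)))

  isRep⇔ : ∀ x → T (isRep ω x) ⇔ (∀ {y} → SameOrbit ω x y → rank x ≤ rank y)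
  isRep⇔ x = mk⇔ to from
    where
    Minimal = ∀ {y} → SameOrbit ω x y → rank x ≤ rank y
    to : T (isRep ω x) → Minimal
    to r s = ≤ᵇ⇒≤ _ _ (All.lookup (all⁺ _ _ r) (Equivalence.from ∈orbitPair⇔SameOrbit s))
    from : Minimal → T (isRep ω x)
    from minimal = all⁻ _ (All.tabulate (λ y∈ → ≤⇒≤ᵇ (minimal (Equivalence.to ∈orbitPair⇔SameOrbit y∈))))

  rep : Pt N → Pt N
  rep x = argmin rank x (orbit ω x ++ orbit ω (bar x))

  SameOrbit-rep : ∀ x → SameOrbit ω x (rep x)
  SameOrbit-rep x with argmin-sel rank x (orbit ω x ++ orbit ω (bar x))
  ... | inj₁ rep≡x = subst (SameOrbit ω x) (sym rep≡x) (SameOrbit-refl x)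
  ... | inj₂ rep∈ = Equivalence.to ∈orbitPair⇔SameOrbit rep∈

  rep-minimal : ∀ {x y} → SameOrbit ω x y → rank (rep x) ≤ rank y
  rep-minimal {x} s = All.lookup (f[argmin]≤f[xs] x _) (Equivalence.from ∈orbitPair⇔SameOrbit s)

  isRep-rep : ∀ x → T (isRep ω (rep x))
  isRep-rep x = Equivalence.from (isRep⇔ (rep x)) (λ s → rep-minimal (SameOrbit-trans (SameOrbit-rep x) s))

  isRep-unique : ∀ {a b} → T (isRep ω a) → T (isRep ω b) → SameOrbit ω a b → a ≡ b
  isRep-unique ra rb s = rank-injective
    (≤-antisym (Equivalence.to (isRep⇔ _) ra s) (Equivalence.to (isRep⇔ _) rb (SameOrbit-sym s)))

record Transversal {N : ℕ} (ω : Perm N) (xs : List (Pt N)) : Set where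
  field
    unique : Unique xs
    covers : ∀ z → ∃ λ x → x ∈ xs × SameOrbit ω z x
    separates : ∀ {x y} → x ∈ xs → y ∈ xs → SameOrbit ω x y → x ≡ y

reps : ∀ {N} → Perm N → List (Pt N)
reps {N} ω = filterᵇ (isRep ω) (allPts N)

cycleTypes : ∀ {N} → Perm N → List (ℕ × Bool)
cycleTypes ω = map (cycleType ω) (reps ω)

Transversal-resp-↭ : ∀ {N} {ω : Perm N} {xs ys} → xs ↭ ys → Transversal ω xs → Transversal ω ys
Transversal-resp-↭ xs↭ys t = record
  { unique = Unique-resp-↭ xs↭ys unique
  ; covers = λ z → let x , x∈ , s = covers z in x , ∈-resp-↭ xs↭ys x∈ , s
  ; separates = λ x∈ y∈ → separates (∈-resp-↭ (↭-sym xs↭ys) x∈) (∈-resp-↭ (↭-sym xs↭ys) y∈)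
  }
  where open Transversal t

module _ {N : ℕ} {ω ω′ : Perm N} (α : Perm N) (α-step : Intertwines α ω′ ω) (α-bar : CommutesWithBar α) where

  open Intertwining {ω = ω} {ω′ = ω′} (app α) (app-injective α) α-step

  transversal-image : ∀ {xs} → Transversal ω′ xs → Transversal ω (map (app α) xs)
  transversal-image {xs} t = record
    { unique = Unique.map⁺ (app-injective α) unique
    ; covers = covers′
    ; separates = separates′
    }
    where
    open Transversal t
    covers′ : ∀ z → ∃ λ x → x ∈ map (app α) xs × SameOrbit ω z x
    covers′ z with x , x∈ , s ← covers (appInv α z) =
      app α x , ∈-map⁺ (app α) x∈
      , subst (λ w → SameOrbit ω w (app α x)) (Inverse.strictlyInverseˡ α z) (SameOrbit-h⁺ α-bar s)
    separates′ : ∀ {x y} → x ∈ map (app α) xs → y ∈ map (app α) xs → SameOrbit ω x y → x ≡ y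
    separates′ x∈ y∈ s with _ , a∈ , refl ← ∈-map⁻ (app α) x∈ | _ , b∈ , refl ← ∈-map⁻ (app α) y∈ =
      cong (app α) (separates a∈ b∈ (SameOrbit-h⁻ α-bar s))

module _ {N : ℕ} {ω : Perm N} (ω-bar : CommutesWithBar ω) where

  open CommutingWithBar {ω = ω} ω-bar

  rep∈reps : ∀ z → rep z ∈ reps ω
  rep∈reps z = ∈-filter⁺ (T? ∘ isRep ω) (∈-allPts (rep z)) (isRep-rep z)

  reps-transversal : Transversal ω (reps ω)
  reps-transversal = record
    { unique = filter⁺ (T? ∘ isRep ω) (allPts-unique N)
    ; covers = λ z → rep z , rep∈reps z , SameOrbit-rep z
    ; separates = λ x∈ y∈ → isRep-unique (isRep-∈reps x∈) (isRep-∈reps y∈)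
    }
    where
    isRep-∈reps : ∀ {x} → x ∈ reps ω → T (isRep ω x)
    isRep-∈reps x∈ = proj₂ (∈-filter⁻ (T? ∘ isRep ω) {xs = allPts N} x∈)

  transversal-exchange : ∀ {x y xs} → Transversal ω (x ∷ xs) → SameOrbit ω x y → Transversal ω (y ∷ xs)
  transversal-exchange {x} {y} {xs} t x~y = record
    { unique = All.tabulate (λ z∈ y≡z → apart z∈ (subst (SameOrbit ω x) y≡z x~y)) ∷ unique-rest
    ; covers = covers′
    ; separates = separates′
    }
    where
    open Transversal t
    unique-rest : Unique xs
    unique-rest with _ ∷ u ← unique = u
    apart : ∀ {z} → z ∈ xs → ¬ SameOrbit ω x z
    apart z∈ x~z with x∉xs ∷ _ ← unique = All.lookup x∉xs z∈ (separates (here refl) (there z∈) x~z)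
    covers′ : ∀ z → ∃ λ w → w ∈ y ∷ xs × SameOrbit ω z w
    covers′ z with covers z
    ... | _ , here refl , z~x = y , here refl , SameOrbit-trans z~x x~y
    ... | w , there w∈ , z~w = w , there w∈ , z~w
    separates′ : ∀ {a b} → a ∈ y ∷ xs → b ∈ y ∷ xs → SameOrbit ω a b → a ≡ b
    separates′ (here refl) (here refl) _ = refl
    separates′ (here refl) (there b∈) y~b = ⊥-elim (apart b∈ (SameOrbit-trans x~y y~b))
    separates′ (there a∈) (here refl) a~y = ⊥-elim (apart a∈ (SameOrbit-trans x~y (SameOrbit-sym a~y)))
    separates′ (there a∈) (there b∈) a~b = separates (there a∈) (there b∈) a~b

  transversal-cycleTypes : ∀ {ts} → Transversal ω ts → map (cycleType ω) ts ↭ cycleTypes ω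
  transversal-cycleTypes {ts} t = begin
    map (cycleType ω) ts             ≡⟨ map-cong-local (All.tabulate (λ {x} _ → sym (cycleType-resp (SameOrbit-rep x)))) ⟩
    map (cycleType ω ∘ rep) ts       ≡⟨ map-∘ ts ⟩
    map (cycleType ω) (map rep ts)   ↭⟨ map⁺ (cycleType ω) (↭-sym reps↭reps-of-ts) ⟩
    map (cycleType ω) (reps ω)       ∎
    where
    open PermutationReasoning
    open Transversal t
    module R = Transversal (reps-transversal)
    rep-injectiveOn : ∀ {a b} → a ∈ ts → b ∈ ts → rep a ≡ rep b → a ≡ b
    rep-injectiveOn {a} {b} a∈ b∈ e =
      separates a∈ b∈ (SameOrbit-trans (SameOrbit-rep a)
        (subst (λ r → SameOrbit ω r b) (sym e) (SameOrbit-sym (SameOrbit-rep b))))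
    same-members : ∀ {z} → (z ∈ reps ω) ⇔ (z ∈ map rep ts)
    same-members {z} = mk⇔ to from
      where
      to : z ∈ reps ω → z ∈ map rep ts
      to z∈ with t , t∈ , z~t ← covers z =
        subst (_∈ map rep ts) (R.separates (rep∈reps t) z∈ (SameOrbit-sym (SameOrbit-trans z~t (SameOrbit-rep t))))
          (∈-map⁺ rep t∈)
      from : z ∈ map rep ts → z ∈ reps ω
      from z∈ with t , _ , refl ← ∈-map⁻ rep z∈ = rep∈reps t
    reps↭reps-of-ts : reps ω ↭ map rep ts
    reps↭reps-of-ts = ∼bag⇒↭ (unique∧set⇒bag R.unique (Unique-map⁺ rep unique rep-injectiveOn) same-members)

  transversal-through : ∀ u → ∃ λ rest → Transversal ω (u ∷ rest)
  transversal-through u with rest , reps↭ ← ∈⇒↭-∷ (rep∈reps u) =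
    rest , transversal-exchange (Transversal-resp-↭ reps↭ reps-transversal) (SameOrbit-sym (SameOrbit-rep u))

-- λ₁ and λ₂ as cycle types: a pair C, C̄ of l-cycles has type (l, false), a self-paired
-- 2d-cycle has type (2d, true).
flagged : List ℕ → List ℕ → List (ℕ × Bool)
flagged ls ds = map (_, false) ls ++ map (λ d → d + d , true) ds

unflagₗ : List (ℕ × Bool) → List ℕ
unflagₗ = map proj₁ ∘ filterᵇ (not ∘ proj₂)

unflagᵣ : List (ℕ × Bool) → List ℕ
unflagᵣ = map (⌊_/2⌋ ∘ proj₁) ∘ filterᵇ proj₂

unflagₗ-flagged : ∀ ls ds → unflagₗ (flagged ls ds) ≡ ls
unflagₗ-flagged (l ∷ ls) ds = cong (l ∷_) (unflagₗ-flagged ls ds)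
unflagₗ-flagged [] (d ∷ ds) = unflagₗ-flagged [] ds
unflagₗ-flagged [] [] = refl

unflagᵣ-flagged : ∀ ls ds → unflagᵣ (flagged ls ds) ≡ ds
unflagᵣ-flagged (l ∷ ls) ds = unflagᵣ-flagged ls ds
unflagᵣ-flagged [] (d ∷ ds) = cong₂ _∷_ (sym (n≡⌊n+n/2⌋ d)) (unflagᵣ-flagged [] ds)
unflagᵣ-flagged [] [] = refl

flagged-↭⇔ : ∀ {ls ds ls′ ds′} → (flagged ls ds ↭ flagged ls′ ds′) ⇔ (ls ↭ ls′ × ds ↭ ds′)
flagged-↭⇔ {ls} {ds} {ls′} {ds′} = mk⇔
  (λ p → subst₂ _↭_ (unflagₗ-flagged ls ds) (unflagₗ-flagged ls′ ds′)
                    (map⁺ proj₁ (filter-↭ (T? ∘ not ∘ proj₂) p))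
       , subst₂ _↭_ (unflagᵣ-flagged ls ds) (unflagᵣ-flagged ls′ ds′)
                    (map⁺ (⌊_/2⌋ ∘ proj₁) (filter-↭ (T? ∘ proj₂) p)))
  (λ (p , q) → ++⁺ (map⁺ _ p) (map⁺ _ q))

cycleTypes-↭-flagged : ∀ {N} {ω : Perm N} → CommutesWithBar ω → cycleTypes ω ↭ flagged (lam1 N ω) (lam2 N ω)
cycleTypes-↭-flagged {N} {ω} ω-bar = begin
  map (cycleType ω) (filterᵇ (isRep ω) (allPts N))
    ↭⟨ map⁺ (cycleType ω) (filterᵇ-split (isRep ω) (selfPaired ω) (allPts N)) ⟩
  map (cycleType ω) (pairReps ++ selfPairedReps)
    ≡⟨ map-++ (cycleType ω) pairReps selfPairedReps ⟩
  map (cycleType ω) pairReps ++ map (cycleType ω) selfPairedReps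
    ≡⟨ cong₂ _++_ (trans (map-cong-local (All.tabulate pair-type)) (map-∘ pairReps))
                  (trans (map-cong-local (All.tabulate selfPaired-type)) (map-∘ selfPairedReps)) ⟩
  flagged (lam1 N ω) (lam2 N ω)
    ∎
  where
  open PermutationReasoning
  open CommutingWithBar {ω = ω} ω-bar
  pairReps = filterᵇ (λ x → isRep ω x ∧ not (selfPaired ω x)) (allPts N)
  selfPairedReps = filterᵇ (λ x → isRep ω x ∧ selfPaired ω x) (allPts N)
  second-filter : ∀ {q : Pt N → Bool} {x} → x ∈ filterᵇ (λ y → isRep ω y ∧ q y) (allPts N) → T (q x)
  second-filter {x = x} x∈ = proj₂ (Equivalence.to (T-∧ {isRep ω x}) (proj₂ (∈-filter⁻ _ {xs = allPts N} x∈)))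
  pair-type : ∀ {x} → x ∈ pairReps → cycleType ω x ≡ (cycLen ω x , false)
  pair-type {x} x∈ = cong (cycLen ω x ,_) (Equivalence.to T-not-≡ (second-filter x∈))
  selfPaired-type : ∀ {x} → x ∈ selfPairedReps → cycleType ω x ≡ (⌊ cycLen ω x /2⌋ + ⌊ cycLen ω x /2⌋ , true)
  selfPaired-type {x} x∈ =
    cong₂ _,_ (proj₂ (selfPaired-structure x (second-filter x∈))) (Equivalence.to T-≡ (second-filter x∈))

marked-≈MT⇔ : ∀ {A₁ A₂ B₁ B₂ : List ℕ} {b₁ b₂ x₁ x₂} →
  (T b₁ → x₁ ≡ ⌊ x₁ /2⌋ + ⌊ x₁ /2⌋) → (T b₂ → x₂ ≡ ⌊ x₂ /2⌋ + ⌊ x₂ /2⌋) →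
  ((if b₁ then mbp A₁ B₁ (suc zero) ⌊ x₁ /2⌋ else mbp A₁ B₁ zero x₁) ≈MT
   (if b₂ then mbp A₂ B₂ (suc zero) ⌊ x₂ /2⌋ else mbp A₂ B₂ zero x₂))
  ⇔ (A₁ ↭ A₂ × B₁ ↭ B₂ × (x₁ , b₁) ≡ (x₂ , b₂))
marked-≈MT⇔ {b₁ = true} {true} even₁ even₂ = mk⇔
  (λ (p , q , _ , h≡h) → p , q , cong (_, true) (trans (even₁ _) (trans (cong₂ _+_ h≡h h≡h) (sym (even₂ _)))))
  (λ { (p , q , refl) → p , q , refl , refl })
marked-≈MT⇔ {b₁ = false} {false} _ _ = mk⇔
  (λ (p , q , _ , x≡x) → p , q , cong (_, false) x≡x)
  (λ { (p , q , refl) → p , q , refl , refl })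
marked-≈MT⇔ {b₁ = true} {false} _ _ = mk⇔ (λ { (_ , _ , () , _) }) (λ { (_ , _ , ()) })
marked-≈MT⇔ {b₁ = false} {true} _ _ = mk⇔ (λ { (_ , _ , () , _) }) (λ { (_ , _ , ()) })

lams-↭⇔cycleTypes-↭ : ∀ {N} {ω₁ ω₂ : Perm N} → CommutesWithBar ω₁ → CommutesWithBar ω₂ →
  (lam1 N ω₁ ↭ lam1 N ω₂ × lam2 N ω₁ ↭ lam2 N ω₂) ⇔ (cycleTypes ω₁ ↭ cycleTypes ω₂)
lams-↭⇔cycleTypes-↭ ω₁-bar ω₂-bar = mk⇔
  (λ lams↭ → ↭-trans (cycleTypes-↭-flagged ω₁-bar)
               (↭-trans (Equivalence.from flagged-↭⇔ lams↭) (↭-sym (cycleTypes-↭-flagged ω₂-bar))))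
  (λ types↭ → Equivalence.to flagged-↭⇔
               (↭-trans (↭-sym (cycleTypes-↭-flagged ω₁-bar)) (↭-trans types↭ (cycleTypes-↭-flagged ω₂-bar))))

markedType-≈MT⇔ : ∀ m {ω₁ ω₂ : Perm (suc m)} → CommutesWithBar ω₁ → CommutesWithBar ω₂ →
  let u = (fromℕ m , zero) in
  (markedType m ω₁ ≈MT markedType m ω₂) ⇔ (cycleTypes ω₁ ↭ cycleTypes ω₂ × cycleType ω₁ u ≡ cycleType ω₂ u)
markedType-≈MT⇔ m {ω₁} {ω₂} ω₁-bar ω₂-bar = mk⇔
  (λ mt → let l₁ , l₂ , u-types = Equivalence.to marked mt in Equivalence.to lams (l₁ , l₂) , u-types)
  (λ (types↭ , u-types) → let l₁ , l₂ = Equivalence.from lams types↭ in Equivalence.from marked (l₁ , l₂ , u-types))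
  where
  u = (fromℕ m , zero)
  lams = lams-↭⇔cycleTypes-↭ ω₁-bar ω₂-bar
  marked = marked-≈MT⇔ {lam1 (suc m) ω₁} {lam1 (suc m) ω₂} {lam2 (suc m) ω₁} {lam2 (suc m) ω₂}
                       {selfPaired ω₁ u} {selfPaired ω₂ u} {cycLen ω₁ u} {cycLen ω₂ u}
                       (proj₂ ∘ CommutingWithBar.selfPaired-structure ω₁-bar u)
                       (proj₂ ∘ CommutingWithBar.selfPaired-structure ω₂-bar u)

module _ {N : ℕ} {ωa ωb : Perm N} (ωa-bar : CommutesWithBar ωa) (ωb-bar : CommutesWithBar ωb) where

  private
    module A = CommutingWithBar {ω = ωa} ωa-bar
    module B = CommutingWithBar {ω = ωb} ωb-bar

  -- Which exponents (s, k) reach the same point of an orbit depends only on its cycle type.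
  barIf-iter-transfer : ∀ {b c} → cycleType ωa b ≡ cycleType ωb c →
    ∀ {s s′ k k′} → barIf s (iter ωa k b) ≡ barIf s′ (iter ωa k′ b) →
                    barIf s (iter ωb k c) ≡ barIf s′ (iter ωb k′ c)
  barIf-iter-transfer {b} {c} types {s} {s′} {k} {k′} e with T? (selfPaired ωa b) | ,-injective types
  ... | yes sp-b | L≡ , sp≡ = begin
    barIf s (iter ωb k c)                         ≡⟨ B.barIf-iter-selfPaired sp-c s k ⟩
    iter ωb (k + halfIf s (cycLen ωb c)) c        ≡⟨ cong (λ L → iter ωb (k + halfIf s L) c) L≡ ⟨
    iter ωb (k + halfIf s (cycLen ωa b)) c        ≡⟨ iter-≡-transfer L≡ i j e-in-cycle ⟩
    iter ωb (k′ + halfIf s′ (cycLen ωa b)) c      ≡⟨ cong (λ L → iter ωb (k′ + halfIf s′ L) c) L≡ ⟩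
    iter ωb (k′ + halfIf s′ (cycLen ωb c)) c      ≡⟨ B.barIf-iter-selfPaired sp-c s′ k′ ⟨
    barIf s′ (iter ωb k′ c)                       ∎
    where
    open ≡-Reasoning
    sp-c = subst T sp≡ sp-b
    i = k + halfIf s (cycLen ωa b)
    j = k′ + halfIf s′ (cycLen ωa b)
    e-in-cycle : iter ωa i b ≡ iter ωa j b
    e-in-cycle = begin
      iter ωa (k + halfIf s (cycLen ωa b)) b     ≡⟨ A.barIf-iter-selfPaired sp-b s k ⟨
      barIf s (iter ωa k b)                      ≡⟨ e ⟩
      barIf s′ (iter ωa k′ b)                    ≡⟨ A.barIf-iter-selfPaired sp-b s′ k′ ⟩
      iter ωa (k′ + halfIf s′ (cycLen ωa b)) b   ∎
  ... | no ¬sp-b | L≡ , _ with refl ← A.barIf-iter-notSelfPaired ¬sp-b {s} {s′} {k} {k′} e =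
    cong (barIf s) (iter-≡-transfer L≡ k k′ (barIf-injective s e))

record Pairing {N : ℕ} (ωa ωb : Perm N) : Set where
  field
    pairs : List (Pt N × Pt N)
    transversalₗ : Transversal ωa (map proj₁ pairs)
    transversalᵣ : Transversal ωb (map proj₂ pairs)
    types-match : ∀ {p} → p ∈ pairs → cycleType ωa (proj₁ p) ≡ cycleType ωb (proj₂ p)

Pairing-swap : ∀ {N} {ωa ωb : Perm N} → Pairing ωa ωb → Pairing ωb ωa
Pairing-swap {ωa = ωa} {ωb} π = record
  { pairs = map swap pairs
  ; transversalₗ = subst (Transversal ωb) (map-∘ pairs) transversalᵣ
  ; transversalᵣ = subst (Transversal ωa) (map-∘ pairs) transversalₗ
  ; types-match = swapped-types
  }
  where
  open Pairing π
  swapped-types : ∀ {q} → q ∈ map swap pairs → cycleType ωb (proj₁ q) ≡ cycleType ωa (proj₂ q)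
  swapped-types q∈ with _ , p∈ , refl ← ∈-map⁻ swap q∈ = sym (types-match p∈)

module Correspondence {N : ℕ} {ωa ωb : Perm N} (ωa-bar : CommutesWithBar ωa) (ωb-bar : CommutesWithBar ωb)
  (π : Pairing ωa ωb) where

  open Pairing π
  private
    module A = CommutingWithBar {ω = ωa} ωa-bar
    module B = CommutingWithBar {ω = ωb} ωb-bar

  Corresponds : Pt N → Pt N → Set
  Corresponds z w = ∃ λ p → p ∈ pairs ×
    ∃₂ λ k s → z ≡ barIf s (iter ωa k (proj₁ p)) × w ≡ barIf s (iter ωb k (proj₂ p))

  decompose : ∀ z → ∃ λ p → p ∈ pairs × SameOrbit ωa (proj₁ p) z
  decompose z with x , x∈ , z~x ← Transversal.covers transversalₗ z
              with p , p∈ , refl ← ∈-map⁻ proj₁ x∈ = p , p∈ , A.SameOrbit-sym z~x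

  image : Pt N → Pt N
  image z = let p , _ , k , s , _ = decompose z in barIf s (iter ωb k (proj₂ p))

  corresponds-image : ∀ z → Corresponds z (image z)
  corresponds-image z = let p , p∈ , k , s , e = decompose z in p , p∈ , k , s , e , refl

  corresponds-functional : ∀ {z w w′} → Corresponds z w → Corresponds z w′ → w ≡ w′
  corresponds-functional (p , p∈ , k , s , refl , refl) (p′ , p′∈ , k′ , s′ , e , refl)
    with refl ← Transversal.separates transversalₗ (∈-map⁺ proj₁ p∈) (∈-map⁺ proj₁ p′∈)
                  (A.SameOrbit-trans (k , s , refl) (A.SameOrbit-sym (k′ , s′ , e)))
    with refl ← Unique-map⁻ proj₁ (Transversal.unique transversalₗ) p∈ p′∈ refl
    = barIf-iter-transfer ωa-bar ωb-bar (types-match p∈) {s} {s′} {k} {k′} e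

  corresponds-step : ∀ {z w} → Corresponds z w → Corresponds (app ωa z) (app ωb w)
  corresponds-step (p , p∈ , k , s , refl , refl) =
    p , p∈ , suc k , s , A.iter-barIf s 1 _ , B.iter-barIf s 1 _

  corresponds-bar : ∀ {z w} → Corresponds z w → Corresponds (bar z) (bar w)
  corresponds-bar (p , p∈ , k , s , refl , refl) = p , p∈ , k , not s , barIf-barIf true s _ , barIf-barIf true s _

-- Opaque because α is only used through the stated properties, and unfolding it is very costly.
opaque
  pairing⇒intertwiner : ∀ {N} {ωa ωb : Perm N} → CommutesWithBar ωa → CommutesWithBar ωb → (π : Pairing ωa ωb) →
    ∃ λ (α : Perm N) → Intertwines α ωa ωb × CommutesWithBar α ×
                       (∀ {p} → p ∈ Pairing.pairs π → app α (proj₁ p) ≡ proj₂ p)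
  pairing⇒intertwiner {N} {ωa} {ωb} ωa-bar ωb-bar π =
    α , (λ y → F.corresponds-functional (F.corresponds-image (app ωa y)) (F.corresponds-step (F.corresponds-image y)))
      , (λ y → F.corresponds-functional (F.corresponds-image (bar y)) (F.corresponds-bar (F.corresponds-image y)))
      , (λ {p} p∈ → F.corresponds-functional (F.corresponds-image (proj₁ p)) (p , p∈ , 0 , false , refl , refl))
    where
    module F = Correspondence ωa-bar ωb-bar π
    module G = Correspondence ωb-bar ωa-bar (Pairing-swap π)
    flipped : ∀ {z w} → F.Corresponds z w → G.Corresponds w z
    flipped (p , p∈ , k , s , ez , ew) = swap p , ∈-map⁺ swap p∈ , k , s , ew , ez
    unflipped : ∀ {z w} → G.Corresponds w z → F.Corresponds z w
    unflipped (q , q∈ , k , s , ew , ez) with p , p∈ , refl ← ∈-map⁻ swap q∈ = p , p∈ , k , s , ez , ew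
    α : Perm N
    α = mk↔ₛ′ F.image G.image
      (λ w → F.corresponds-functional (F.corresponds-image (G.image w)) (unflipped (G.corresponds-image w)))
      (λ z → G.corresponds-functional (G.corresponds-image (F.image z)) (flipped (F.corresponds-image z)))

fixing-intertwiner⇒types : ∀ {N} {ω₁ ω₂ : Perm N} → CommutesWithBar ω₁ → CommutesWithBar ω₂ →
  ∀ (α : Perm N) {u} → Intertwines α ω₂ ω₁ → CommutesWithBar α → app α u ≡ u →
  cycleTypes ω₁ ↭ cycleTypes ω₂ × cycleType ω₁ u ≡ cycleType ω₂ u
fixing-intertwiner⇒types {ω₁ = ω₁} {ω₂} ω₁-bar ω₂-bar α {u} α-step α-bar αu≡u = (begin
  cycleTypes ω₁
    ↭⟨ transversal-cycleTypes ω₁-bar (transversal-image α α-step α-bar (reps-transversal ω₂-bar)) ⟨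
  map (cycleType ω₁) (map (app α) (reps ω₂))  ≡⟨ map-∘ (reps ω₂) ⟨
  map (cycleType ω₁ ∘ app α) (reps ω₂)        ≡⟨ map-cong α-types (reps ω₂) ⟩
  cycleTypes ω₂                               ∎)
  , trans (cong (cycleType ω₁) (sym αu≡u)) (α-types u)
  where
  open PermutationReasoning
  α-types = Intertwining.cycleType-h (app α) (app-injective α) α-step α-bar

transversals⇒pairing : ∀ {N} {ωa ωb : Perm N} → CommutesWithBar ωa → CommutesWithBar ωb →
  cycleTypes ωa ↭ cycleTypes ωb →
  ∀ {a b as bs} → Transversal ωa (a ∷ as) → Transversal ωb (b ∷ bs) → cycleType ωa a ≡ cycleType ωb b →
  Σ (Pairing ωa ωb) λ π → (a , b) ∈ Pairing.pairs π
transversals⇒pairing {ωa = ωa} {ωb} ωa-bar ωb-bar types↭ {a} {b} {as} {bs} Ta Tb ab-types = record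
    { pairs = (a , b) ∷ M
    ; transversalₗ = Transversal-resp-↭ (prep a (↭-sym M↭as)) Ta
    ; transversalᵣ = Transversal-resp-↭ (prep b (↭-sym M↭bs)) Tb
    ; types-match = λ { (here refl) → ab-types ; (there p∈) → matched p∈ }
    }
  , here refl
  where
  heads-aligned : cycleType ωa a ∷ map (cycleType ωa) as ↭ cycleType ωa a ∷ map (cycleType ωb) bs
  heads-aligned = begin
    map (cycleType ωa) (a ∷ as)            ↭⟨ transversal-cycleTypes ωa-bar Ta ⟩
    cycleTypes ωa                          ↭⟨ types↭ ⟩
    cycleTypes ωb                          ↭⟨ transversal-cycleTypes ωb-bar Tb ⟨
    map (cycleType ωb) (b ∷ bs)            ≡⟨ cong (_∷ map (cycleType ωb) bs) ab-types ⟨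
    cycleType ωa a ∷ map (cycleType ωb) bs ∎
    where open PermutationReasoning
  matching = ↭-matching (cycleType ωa) (cycleType ωb) as bs (drop-∷ heads-aligned)
  M = proj₁ matching
  M↭as = proj₁ (proj₂ matching)
  M↭bs = proj₁ (proj₂ (proj₂ matching))
  matched = proj₂ (proj₂ (proj₂ matching))

types⇒fixing-intertwiner : ∀ {N} {ω₁ ω₂ : Perm N} → CommutesWithBar ω₁ → CommutesWithBar ω₂ →
  ∀ {u} → cycleTypes ω₁ ↭ cycleTypes ω₂ × cycleType ω₁ u ≡ cycleType ω₂ u →
  ∃ λ (α : Perm N) → Intertwines α ω₂ ω₁ × CommutesWithBar α × app α u ≡ u
types⇒fixing-intertwiner ω₁-bar ω₂-bar {u} (types↭ , u-types) =
  let π , uu∈ = transversals⇒pairing ω₂-bar ω₁-bar (↭-sym types↭)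
                  (proj₂ (transversal-through ω₂-bar u)) (proj₂ (transversal-through ω₁-bar u)) (sym u-types)
      α , α-step , α-bar , α-pairs = pairing⇒intertwiner ω₂-bar ω₁-bar π
  in α , α-step , α-bar , α-pairs uu∈

conjugate⇔intertwines : ∀ {N} (α ω₁ ω₂ : Perm N) →
  (∀ x → app ω₁ x ≡ app α (app ω₂ (appInv α x))) ⇔ Intertwines α ω₂ ω₁
conjugate⇔intertwines α ω₁ ω₂ = mk⇔
  (λ conj y → trans (cong (app α ∘ app ω₂) (sym (Inverse.strictlyInverseʳ α y))) (sym (conj (app α y))))
  (λ step x → trans (cong (app ω₁) (sym (Inverse.strictlyInverseˡ α x))) (sym (step (appInv α x))))

mainTheorem3 : (m : ℕ) → (ω₁ ω₂ : Perm (suc m)) → InH (suc m) ω₁ → InH (suc m) ω₂ →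
    HsubConj m ω₁ ω₂ ⇔ (markedType m ω₁ ≈MT markedType m ω₂)
mainTheorem3 m ω₁ ω₂ ω₁∈H ω₂∈H = mk⇔ forward backward
  where
  ω₁-bar = InH⇒CommutesWithBar {ω = ω₁} ω₁∈H
  ω₂-bar = InH⇒CommutesWithBar {ω = ω₂} ω₂∈H
  marked = markedType-≈MT⇔ m ω₁-bar ω₂-bar
  forward : HsubConj m ω₁ ω₂ → markedType m ω₁ ≈MT markedType m ω₂
  forward (α , (α∈H , αu≡u , _) , conj) = Equivalence.from marked
    (fixing-intertwiner⇒types ω₁-bar ω₂-bar α (Equivalence.to (conjugate⇔intertwines α ω₁ ω₂) conj)
                              (InH⇒CommutesWithBar {ω = α} α∈H) αu≡u)
  backward : markedType m ω₁ ≈MT markedType m ω₂ → HsubConj m ω₁ ω₂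
  backward mt =
    let α , α-step , α-bar , αu≡u = types⇒fixing-intertwiner ω₁-bar ω₂-bar (Equivalence.to marked mt)
    in α , (CommutesWithBar⇒InH {ω = α} α-bar , αu≡u , trans (α-bar _) (cong bar αu≡u))
         , Equivalence.from (conjugate⇔intertwines α ω₁ ω₂) α-step
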